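{- Let $G=(U,V,E)$ be a bipartite graph with $|U|=|V|=N$, and run the simplified auction algorithm on $G$. Let $i\geq0$ be such that $M(i)$ is not a maximum matching, let $l\geq 0$ be an integer, and let $u_0\in U$ be free with respect to $M(i)$ with $n_{u_0}\subseteq D_l(i)$. Then every augmenting path of $G$ with respect to $M(i)$ starting at $u_0$ has length at least $2l+1$.
   Context: For a vertex $w$, $n_w$ denotes its set of neighbours. A vertex is free with respect to a matching $M$ if no edge of $M$ is incident to it. A path of length $l$ is a sequence of $l+1$ vertices $v_1,\dots,v_{l+1}$ with $\{v_k,v_{k+1}\}\in E$; it is alternating with respect to $M$ if $(v_k,v_{k+1})\notin M$ for odd $k$ and $(v_k,v_{k+1})\in M$ for even $k$; an augmenting path for $M$ is an alternating path starting at a free vertex of $U$ and ending at a free vertex of $V$. The simplified auction algorithm maintains a matching $M\subseteq E$ and integer values $h_v$, $v\in V$: initially $M=\emptyset$, $h_v=0$. While $|M|<N$ and $\sum_{v\in V}h_v<N(N-1)$, it performs one iteration: choose (arbitrarily) a free vertex $u\in U$; choose $j\in\arg\min_{v\in n_u}h_v$ (ties arbitrary); if some $u_{old}$ has $(u_{old},j)\in M$, remove that edge; add $(u,j)$ to $M$; set $h_j\leftarrow h_j+1$. $M(i)$ and $h_v(i)$ denote the matching and values after $i$ iterations, and $D_l(i)=\{v\in V:h_v(i)\geq l\}$. -}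

module Defs where

open import Data.Nat using (ℕ; zero; suc; _+_; _*_; _∸_; _≤_; _<_)
open import Data.Fin using (Fin; _≟_)
open import Data.Bool using (Bool; true; false; if_then_else_; not)
open import Data.List using (List; []; _∷_; map; allFin; length)
open import Data.Nat.ListAction using (sum)
open import Data.Sum using (_⊎_; inj₁; inj₂)
open import Data.Product using (_×_; Σ; ∃; _,_)
open import Data.Unit using (⊤)
open import Data.Empty using (⊥)
open import Relation.Nullary using (¬_)
open import Relation.Nullary.Decidable using (⌊_⌋)
open import Relation.Binary.PropositionalEquality using (_≡_)

-- Bipartite graph G = (U, V, E) with U = V = Fin N:
-- E u v ≡ true  iff  {u, v} ∈ E  (u ∈ U, v ∈ V).
Graph : ℕ → Set
Graph N = Fin N → Fin N → Bool

EdgeSet : ℕ → Set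
EdgeSet N = Fin N → Fin N → Bool

Values : ℕ → Set
Values N = Fin N → ℕ

size : ∀ {N} → EdgeSet N → ℕ
size {N} M = sum (map (λ u → sum (map (λ v → if M u v then 1 else 0) (allFin N))) (allFin N))

sumH : ∀ {N} → Values N → ℕ
sumH {N} h = sum (map h (allFin N))

IsMatching : ∀ {N} → Graph N → EdgeSet N → Set
IsMatching E M =
  (∀ u v → M u v ≡ true → E u v ≡ true) ×
  (∀ u v v' → M u v ≡ true → M u v' ≡ true → v ≡ v') ×
  (∀ u u' v → M u v ≡ true → M u' v ≡ true → u ≡ u')

IsMaximumMatching : ∀ {N} → Graph N → EdgeSet N → Set
IsMaximumMatching E M =
  IsMatching E M × (∀ M' → IsMatching E M' → size M' ≤ size M)

FreeU : ∀ {N} → EdgeSet N → Fin N → Set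
FreeU M u = ∀ v → M u v ≡ false

FreeV : ∀ {N} → EdgeSet N → Fin N → Set
FreeV M v = ∀ u → M u v ≡ false

-- One iteration: remove (u_old , j) if present, add (u , j); h_j ← h_j + 1.
updM : ∀ {N} → EdgeSet N → Fin N → Fin N → EdgeSet N
updM M u j u' v = if ⌊ v ≟ j ⌋ then ⌊ u' ≟ u ⌋ else M u' v

updH : ∀ {N} → Values N → Fin N → Values N
updH h j v = if ⌊ v ≟ j ⌋ then suc (h v) else h v

-- Reach E i M h : (M , h) = (M(i) , h(i)) for some execution of the
-- simplified auction algorithm on E (all arbitrary choices allowed).
data Reach {N : ℕ} (E : Graph N) : ℕ → EdgeSet N → Values N → Set where
  init : Reach E 0 (λ _ _ → false) (λ _ → 0)
  step : ∀ {i M h} → Reach E i M h →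
         size M < N → sumH h < N * (N ∸ 1) →
         (u j : Fin N) → FreeU M u →
         E u j ≡ true → (∀ v → E u v ≡ true → h j ≤ h v) →
         Reach E (suc i) (updM M u j) (updH h j)

-- Vertices of G: inj₁ u for u ∈ U, inj₂ v for v ∈ V.
Vertex : ℕ → Set
Vertex N = Fin N ⊎ Fin N

Adj : ∀ {N} → Graph N → Vertex N → Vertex N → Set
Adj E (inj₁ u) (inj₂ v) = E u v ≡ true
Adj E (inj₂ v) (inj₁ u) = E u v ≡ true
Adj E _ _ = ⊥

InM : ∀ {N} → EdgeSet N → Vertex N → Vertex N → Set
InM M (inj₁ u) (inj₂ v) = M u v ≡ true
InM M (inj₂ v) (inj₁ u) = M u v ≡ true
InM M _ _ = ⊥

-- Alt odd x ys : the path x ∷ ys is a path in G, alternating w.r.t. M,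
-- where the first edge has odd index iff odd ≡ true.
Alt : ∀ {N} → Graph N → EdgeSet N → Bool → Vertex N → List (Vertex N) → Set
Alt E M b x [] = ⊤
Alt E M b x (y ∷ ys) =
  Adj E x y × (if b then ¬ InM M x y else InM M x y) × Alt E M (not b) y ys

lastV : ∀ {N} → Vertex N → List (Vertex N) → Vertex N
lastV x [] = x
lastV x (y ∷ ys) = lastV y ys

-- The path u0 ∷ ys (of length  length ys ) is an augmenting path for M.
AugmentingPath : ∀ {N} → Graph N → EdgeSet N → Fin N → List (Vertex N) → Set
AugmentingPath E M u0 ys =
  FreeU M u0 × Alt E M true (inj₁ u0) ys ×
  Σ _ (λ v → lastV (inj₁ u0) ys ≡ inj₂ v × FreeV M v)

-- The algorithm keeps every matched edge (u , j) nearly optimal for u: h j exceeds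
-- the value of every neighbour of u by at most 1, and a free vertex of V still has
-- value 0.  Walking an augmenting path backwards from its free endpoint, each
-- matched/unmatched pair of edges raises the value by at most 1, so the first vertex
-- of V on the path, a neighbour of u₀ with value at least l, lies at distance ≥ 2l
-- from the end.
module Submission where

open import Defs
open import Data.Nat using (ℕ; _+_; _*_; _≤_; suc; s≤s)
open import Data.Nat.Properties
  using (≤-refl; ≤-trans; n≤1+n; *-monoʳ-≤; *-suc; +-identityʳ; +-comm; module ≤-Reasoning)
open import Data.Fin using (Fin; _≟_)
open import Data.List using (List; length; []; _∷_)
open import Data.Sum using (inj₁; inj₂)
open import Data.Product using (_,_)
open import Data.Bool using (true; false)
open import Relation.Nullary using (¬_; yes; no; contradiction)
open import Relation.Binary.PropositionalEquality using (_≡_; refl; cong)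

private
  variable
    N : ℕ

updH-mono : (h : Values N) (j v : Fin N) → h v ≤ updH h j v
updH-mono h j v with v ≟ j
... | yes _ = n≤1+n (h v)
... | no _  = ≤-refl

NearlyMinimal : Graph N → EdgeSet N → Values N → Set
NearlyMinimal E M h = ∀ u j → M u j ≡ true → ∀ v → E u v ≡ true → h j ≤ suc (h v)

module _ {E : Graph N} where

  reach-nearlyMinimal : ∀ {i M h} → Reach E i M h → NearlyMinimal E M h
  reach-nearlyMinimal init _ _ () _ _
  reach-nearlyMinimal (step {h = h} r _ _ u j _ _ j-minimal) u′ j′ m v e
    with j′ ≟ j
  ... | no _ = ≤-trans (reach-nearlyMinimal r u′ j′ m v e) (s≤s (updH-mono h j v))
  ... | yes refl with u′ ≟ u
  ...   | yes refl = s≤s (≤-trans (j-minimal v e) (updH-mono h j v))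
  ...   | no _     = contradiction m λ ()

  reach-freeV-value≡0 : ∀ {i M h} → Reach E i M h → ∀ v → FreeV M v → h v ≡ 0
  reach-freeV-value≡0 init v _ = refl
  reach-freeV-value≡0 (step {h = h} r _ _ u j _ _ _) v free with v ≟ j
  ... | no _ = reach-freeV-value≡0 r v free
  ... | yes refl with u ≟ u | free u
  ...   | yes _  | ()
  ...   | no u≢u | _ = contradiction refl u≢u

alternating-value-bound : {E : Graph N} {M : EdgeSet N} {h : Values N} →
  NearlyMinimal E M h → ∀ v w ys → Alt E M false (inj₂ v) ys →
  lastV (inj₂ v) ys ≡ inj₂ w → 2 * h v ≤ length ys + 2 * h w
alternating-value-bound nm v w [] _ refl = ≤-refl
alternating-value-bound nm v w (inj₂ _ ∷ _) (() , _) _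
alternating-value-bound nm v w (inj₁ u ∷ []) _ ()
alternating-value-bound nm v w (inj₁ u ∷ inj₁ _ ∷ _) (_ , _ , () , _) _
alternating-value-bound {h = h} nm v w (inj₁ u ∷ inj₂ v′ ∷ ys) (_ , m , e , _ , alt) end =
  begin
  2 * h v                   ≤⟨ *-monoʳ-≤ 2 (nm u v m v′ e) ⟩
  2 * suc (h v′)            ≡⟨ *-suc 2 (h v′) ⟩
  2 + 2 * h v′              ≤⟨ s≤s (s≤s (alternating-value-bound nm v′ w ys alt end)) ⟩
  2 + (length ys + 2 * h w) ∎
  where open ≤-Reasoning

-- The hypothesis that M is not maximum only guarantees that augmenting paths exist;
-- the bound does not need it.
mainTheorem5 : (N : ℕ) (E : Graph N) (i : ℕ) (M : EdgeSet N) (h : Values N) →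
    Reach E i M h → ¬ IsMaximumMatching E M →
    (l : ℕ) (u₀ : Fin N) → FreeU M u₀ → (∀ v → E u₀ v ≡ true → l ≤ h v) →
    (ys : List (Vertex N)) → AugmentingPath E M u₀ ys →
    2 * l + 1 ≤ length ys
mainTheorem5 N E i M h r _ l u₀ _ l≤h [] (_ , _ , _ , () , _)
mainTheorem5 N E i M h r _ l u₀ _ l≤h (inj₁ _ ∷ ys) (_ , (() , _) , _)
mainTheorem5 N E i M h r _ l u₀ _ l≤h (inj₂ v ∷ ys) (_ , (e , _ , alt) , w , end , free) =
  begin
  2 * l + 1                 ≡⟨ +-comm (2 * l) 1 ⟩
  suc (2 * l)               ≤⟨ s≤s (*-monoʳ-≤ 2 (l≤h v e)) ⟩
  suc (2 * h v)             ≤⟨ s≤s (alternating-value-bound (reach-nearlyMinimal r) v w ys alt end) ⟩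
  suc (length ys + 2 * h w) ≡⟨ cong (λ x → suc (length ys + 2 * x)) (reach-freeV-value≡0 r w free) ⟩
  suc (length ys + 0)       ≡⟨ cong suc (+-identityʳ (length ys)) ⟩
  suc (length ys)           ∎
  where open ≤-Reasoning
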